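{- For every positive integers $n$ and $r$ with $n\geqslant r+1$, there exists a proper edge coloring $c: E(K_n)\to\mathbb{R}$ such that $\dim W_c(K_n, r)\geqslant\binom{r+1}{2}$.
   Context: All graphs are finite, simple and undirected. $K_n$ is the complete graph on $n$ vertices. For a positive integer $r$ and a graph $G$ with a proper edge coloring $c:E(G)\to\mathbb{R}$ (adjacent edges receive different real values), $W_c(G,r)$ is the real vector space of all functions $\phi:E(G)\to\mathbb{R}$ for which there exist real polynomials $\{P_v(x)\}_{v\in V(G)}$ such that (i) $\deg P_v\leqslant r-1$ for every vertex $v$, and (ii) $P_u(c(uv))=P_v(c(uv))=\phi(uv)$ for every edge $uv\in E(G)$. -}

module Defs where

open import Level using (Level; _⊔_) renaming (suc to lsuc)
open import Data.Nat as ℕ using (ℕ; zero; suc)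
open import Data.Fin using (Fin)
open import Data.Product using (Σ; ∃; _×_; _,_)
open import Data.Sum using (_⊎_)
open import Relation.Nullary using (¬_)
open import Relation.Binary.Core using (Rel)
open import Relation.Binary.Structures using (IsStrictTotalOrder)
open import Relation.Binary.PropositionalEquality using (_≡_; _≢_)
open import Relation.Unary using (Pred; _∈_)
open import Algebra.Bundles using (CommutativeRing)

-- An abstract model of the real numbers: a complete ordered field
-- (all such models are isomorphic to ℝ).
record RealField (c ℓ : Level) : Set (lsuc (c ⊔ ℓ)) where
  field
    commutativeRing : CommutativeRing c ℓ
  open CommutativeRing commutativeRing public
  field
    _<_               : Rel Carrier ℓ
    isStrictTotalOrder : IsStrictTotalOrder _≈_ _<_
    1≉0               : ¬ (1# ≈ 0#)
    inverse           : ∀ x → ¬ (x ≈ 0#) → ∃ λ y → x * y ≈ 1#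
    +-mono-<          : ∀ x y z → x < y → (x + z) < (y + z)
    *-pos             : ∀ x y → 0# < x → 0# < y → 0# < (x * y)

  _≤_ : Rel Carrier ℓ
  x ≤ y = (x < y) ⊎ (x ≈ y)

  IsUpperBound : Pred Carrier ℓ → Carrier → Set (c ⊔ ℓ)
  IsUpperBound S b = ∀ x → x ∈ S → x ≤ b

  field
    complete : (S : Pred Carrier ℓ) → (∃ λ x → x ∈ S) → (∃ λ b → IsUpperBound S b) →
               ∃ λ s → IsUpperBound S s × (∀ b → IsUpperBound S b → s ≤ b)

module _ {c ℓ : Level} (ℝ : RealField c ℓ) where
  open RealField ℝ

  sumFin : ∀ k → (Fin k → Carrier) → Carrier
  sumFin zero    f = 0#
  sumFin (suc k) f = f Data.Fin.zero + sumFin k (λ i → f (Data.Fin.suc i))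

  pow : Carrier → ℕ → Carrier
  pow x zero    = 1#
  pow x (suc m) = x * pow x m

  -- a real polynomial of degree ≤ r-1 is given by its r coefficients
  Poly : ℕ → Set c
  Poly r = Fin r → Carrier

  eval : ∀ {r} → Poly r → Carrier → Carrier
  eval {r} p x = sumFin r (λ i → p i * pow x (Data.Fin.toℕ i))

  -- Edge functions on K_n: values on ordered pairs (i , j) with i ≢ j;
  -- the value for the edge ij is f i j (= f j i where required).
  EdgeFun : ℕ → Set c
  EdgeFun n = Fin n → Fin n → Carrier

  IsProperColoring : ∀ n → EdgeFun n → Set ℓ
  IsProperColoring n col =
    (∀ i j → i ≢ j → col i j ≈ col j i) ×
    (∀ i j k → i ≢ j → i ≢ k → j ≢ k → ¬ (col i j ≈ col i k))

  InW : ∀ n r → EdgeFun n → EdgeFun n → Set (c ⊔ ℓ)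
  InW n r col φ = ∃ λ (P : Fin n → Poly r) →
    ∀ i j → i ≢ j → (eval (P i) (col i j) ≈ φ i j) × (eval (P j) (col i j) ≈ φ i j)

  LinIndep : ∀ n k → (Fin k → EdgeFun n) → Set (c ⊔ ℓ)
  LinIndep n k φ = ∀ (a : Fin k → Carrier) →
    (∀ i j → i ≢ j → sumFin k (λ l → a l * φ l i j) ≈ 0#) → ∀ l → a l ≈ 0#

  -- dim W_c(K_n, r) ≥ k  :⇔  W_c(K_n,r) contains k linearly independent elements
  DimW≥ : ∀ n r → EdgeFun n → ℕ → Set (c ⊔ ℓ)
  DimW≥ n r col k = ∃ λ (φ : Fin k → EdgeFun n) → (∀ l → InW n r col (φ l)) × LinIndep n k φ

module Submission where

-- Let m = r + 1 ≤ n and let s : Fin n → ℝ be injective (s i = i).  Colour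
-- the edge ij of K_n by c(ij) = s i + s j; this is proper since
-- s i + s j = s i + s k forces j = k.
--
-- If V(y) = ∏ₜ (y - ρₜ) has r - 1 roots, the edge function
-- φ(ij) = V(s i) · V(s j) lies in W_c(K_n, r): at vertex v take
-- P_v(x) = V(s v) · ∏ₜ (x - s v - ρₜ), of degree r - 1, which at
-- x = s v + s w takes the value V(s v) · V(s w).
--
-- For every pair {a < b} of the first m vertices let V_{ab} have as roots
-- the values of the other m - 2 = r - 1 of those vertices.  Then φ_{ab} is
-- nonzero on the edge ab, while every other φ_{a'b'} vanishes there,
-- because one of a, b is a root of V_{a'b'}.  Such a "diagonal" family is
-- linearly independent, giving (m choose 2) = (r+1 choose 2) independent
-- elements of W_c(K_n, r).

open import Defs
open import Level using (Level)
open import Function using (_∘_)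
open import Data.Nat as ℕ using (ℕ; zero; suc; _≥_; NonZero)
import Data.Nat.Properties as ℕP
open import Data.Nat.Combinatorics using (_C_; nC1≡n; nCk+nC[k+1]≡[n+1]C[k+1])
open import Data.Fin as Fin using (Fin; toℕ; fromℕ; inject₁; inject≤; punchIn; punchOut; splitAt; join)
import Data.Fin.Properties as FinP
open import Data.Vec.Functional using (head; tail)
open import Data.Product as Prod using (∃; _×_; _,_; proj₁; proj₂)
open import Data.Sum using (_⊎_; inj₁; inj₂)
open import Data.Empty using (⊥-elim)
open import Relation.Nullary using (¬_; Dec; yes; no)
open import Relation.Nullary.Decidable using (_⊎-dec_)
open import Relation.Binary.Definitions using (tri<; tri≈; tri>)
import Relation.Binary.PropositionalEquality as ≡
open ≡ using (_≡_; _≢_; cong; cong₂; subst; subst₂)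

-- The number of 2-element subsets of an m-element set, split according to
-- whether the pair contains the last element.
pairCount : ℕ → ℕ
pairCount zero    = 0
pairCount (suc m) = m ℕ.+ pairCount m

pairCount≡C2 : ∀ m → pairCount m ≡ m C 2
pairCount≡C2 zero    = ≡.refl
pairCount≡C2 (suc m) =
  ≡.trans (cong₂ ℕ._+_ (≡.sym (nC1≡n m)) (pairCount≡C2 m)) (nCk+nC[k+1]≡[n+1]C[k+1] m 1)

-- Enumeration of the pairs (a , b), a < b, in Fin m: the first m indices are
-- the pairs (x , m), the remaining ones the pairs of Fin m, lifted.
pair : ∀ m → Fin (pairCount m) → Fin m × Fin m
pair (suc m) l with splitAt m l
... | inj₁ x = inject₁ x , fromℕ m
... | inj₂ y = Prod.map inject₁ inject₁ (pair m y)

pair-ordered : ∀ m (l : Fin (pairCount m)) → proj₁ (pair m l) Fin.< proj₂ (pair m l)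
pair-ordered (suc m) l with splitAt m l
... | inj₁ x = subst (toℕ (inject₁ x) ℕ.<_) (≡.sym (FinP.toℕ-fromℕ m)) (FinP.inject₁ℕ< x)
... | inj₂ y = subst₂ ℕ._<_ (≡.sym (FinP.toℕ-inject₁ (proj₁ (pair m y))))
                           (≡.sym (FinP.toℕ-inject₁ (proj₂ (pair m y)))) (pair-ordered m y)

splitAt-injective : ∀ m {n} {i j : Fin (m ℕ.+ n)} → splitAt m i ≡ splitAt m j → i ≡ j
splitAt-injective m {n} {i} {j} eq =
  ≡.trans (≡.sym (FinP.join-splitAt m n i)) (≡.trans (cong (join m n) eq) (FinP.join-splitAt m n j))

pair-injective : ∀ m {l l' : Fin (pairCount m)} → pair m l ≡ pair m l' → l ≡ l'
pair-injective (suc m) {l} {l'} eq with splitAt m l in el | splitAt m l' in el'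
... | inj₁ x | inj₁ x' = splitAt-injective m
  (≡.trans el (≡.trans (cong inj₁ (FinP.inject₁-injective (cong proj₁ eq))) (≡.sym el')))
... | inj₁ _ | inj₂ _ = ⊥-elim (FinP.fromℕ≢inject₁ (cong proj₂ eq))
... | inj₂ _ | inj₁ _ = ⊥-elim (FinP.fromℕ≢inject₁ (≡.sym (cong proj₂ eq)))
... | inj₂ y | inj₂ y' = splitAt-injective m (≡.trans el (≡.trans (cong inj₂ y≡y') (≡.sym el')))
  where
  y≡y' : y ≡ y'
  y≡y' = pair-injective m (cong₂ _,_ (FinP.inject₁-injective (cong proj₁ eq))
                                     (FinP.inject₁-injective (cong proj₂ eq)))

module Pairs (m : ℕ) where

  lo hi : Fin (pairCount m) → Fin m
  lo l = proj₁ (pair m l)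
  hi l = proj₂ (pair m l)

  lo≢hi : ∀ l → lo l ≢ hi l
  lo≢hi l = FinP.<⇒≢ (pair-ordered m l)

  _∈ₚ_ : Fin m → Fin (pairCount m) → Set
  x ∈ₚ l = x ≡ lo l ⊎ x ≡ hi l

  _∈ₚ?_ : ∀ x l → Dec (x ∈ₚ l)
  x ∈ₚ? l = (x Fin.≟ lo l) ⊎-dec (x Fin.≟ hi l)

  -- A pair is determined by its set of endpoints (as lo < hi on both sides).
  pair-determined : ∀ {l l'} → lo l ∈ₚ l' → hi l ∈ₚ l' → l ≡ l'
  pair-determined {l} (inj₁ e₁) (inj₁ e₂) = ⊥-elim (lo≢hi l (≡.trans e₁ (≡.sym e₂)))
  pair-determined     (inj₁ e₁) (inj₂ e₂) = pair-injective m (cong₂ _,_ e₁ e₂)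
  pair-determined {l} {l'} (inj₂ e₁) (inj₁ e₂) =
    ⊥-elim (FinP.<-asym (pair-ordered m l') (subst₂ Fin._<_ e₁ e₂ (pair-ordered m l)))
  pair-determined {l} (inj₂ e₁) (inj₂ e₂) = ⊥-elim (lo≢hi l (≡.trans e₁ (≡.sym e₂)))

  pair-separated : ∀ {l l'} → l' ≢ l → ¬ lo l ∈ₚ l' ⊎ ¬ hi l ∈ₚ l'
  pair-separated {l} {l'} l'≢l with lo l ∈ₚ? l' | hi l ∈ₚ? l'
  ... | no lo∉  | _       = inj₁ lo∉
  ... | yes _   | no hi∉  = inj₂ hi∉
  ... | yes lo∈ | yes hi∈ = ⊥-elim (l'≢l (≡.sym (pair-determined lo∈ hi∈)))

-- The k elements of Fin (2 + k) other than two distinct elements a and b.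
others : ∀ {k} {a b : Fin (suc (suc k))} → a ≢ b → Fin k → Fin (suc (suc k))
others {a = a} a≢b t = punchIn a (punchIn (punchOut a≢b) t)

others≢left : ∀ {k} {a b : Fin (suc (suc k))} (a≢b : a ≢ b) t → others a≢b t ≢ a
others≢left {a = a} a≢b t = FinP.punchInᵢ≢i a _

others≢right : ∀ {k} {a b : Fin (suc (suc k))} (a≢b : a ≢ b) t → others a≢b t ≢ b
others≢right {a = a} a≢b t e = FinP.punchInᵢ≢i (punchOut a≢b) t
  (FinP.punchIn-injective a _ _ (≡.trans e (≡.sym (FinP.punchIn-punchOut a≢b))))

others-cover : ∀ {k} {a b x : Fin (suc (suc k))} (a≢b : a ≢ b) →
               a ≢ x → b ≢ x → ∃ λ t → others a≢b t ≡ x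
others-cover {a = a} a≢b a≢x b≢x = punchOut b′≢x′ ,
  ≡.trans (cong (punchIn a) (FinP.punchIn-punchOut b′≢x′)) (FinP.punchIn-punchOut a≢x)
  where
  b′≢x′ : punchOut a≢b ≢ punchOut a≢x
  b′≢x′ e = b≢x (FinP.punchOut-injective a≢b a≢x e)

module _ {c ℓ : Level} (ℝ : RealField c ℓ) where
  open RealField ℝ
  open import Relation.Binary.Reasoning.Setoid setoid
  open import Algebra.Properties.Semiring.Sum semiring
    using (sum; sum-remove; sum-cong-≋; sum-replicate-zero; *-distribˡ-sum)
  open import Algebra.Properties.CommutativeSemigroup *-commutativeSemigroup using (x∙yz≈y∙xz)
  open import Algebra.Properties.Group +-group using (∙-cancelˡ; x∙y⁻¹≈ε⇒x≈y)
  open import Algebra.Properties.AbelianGroup +-abelianGroup using (⁻¹-∙-comm; ⁻¹-involutive)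
  open import Algebra.Properties.Ring ring using (-1*x≈-x)
  open import Algebra.Solver.Ring.NaturalCoefficients.Default commutativeSemiring
    using (solve; _:+_; _:*_; _:=_)
  open import Relation.Binary.Structures using (IsStrictTotalOrder)
  open IsStrictTotalOrder isStrictTotalOrder
    using (compare; irrefl; <-respʳ-≈; <-respˡ-≈) renaming (trans to <-trans)

  cancel-nonzeroʳ : ∀ {x y} → ¬ y ≈ 0# → x * y ≈ 0# → x ≈ 0#
  cancel-nonzeroʳ {x} {y} y≉0 xy≈0 with inverse y y≉0
  ... | y⁻¹ , yy⁻¹≈1 = begin
    x              ≈⟨ sym (*-identityʳ x) ⟩
    x * 1#         ≈⟨ *-congˡ (sym yy⁻¹≈1) ⟩
    x * (y * y⁻¹)  ≈⟨ sym (*-assoc x y y⁻¹) ⟩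
    (x * y) * y⁻¹  ≈⟨ *-congʳ xy≈0 ⟩
    0# * y⁻¹       ≈⟨ zeroˡ y⁻¹ ⟩
    0#             ∎

  *-nonzero : ∀ {x y} → ¬ x ≈ 0# → ¬ y ≈ 0# → ¬ (x * y) ≈ 0#
  *-nonzero x≉0 y≉0 xy≈0 = x≉0 (cancel-nonzeroʳ y≉0 xy≈0)

  sumFin≡sum : ∀ k (f : Fin k → Carrier) → sumFin ℝ k f ≡ sum f
  sumFin≡sum zero    f = ≡.refl
  sumFin≡sum (suc k) f = cong (f Fin.zero +_) (sumFin≡sum k (tail f))

  sum-single : ∀ {k} (f : Fin k → Carrier) i → (∀ j → j ≢ i → f j ≈ 0#) → sumFin ℝ k f ≈ f i
  sum-single {suc k} f i vanish = begin
    sumFin ℝ (suc k) f        ≡⟨ sumFin≡sum (suc k) f ⟩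
    sum f                     ≈⟨ sum-remove {i = i} f ⟩
    f i + sum (f ∘ punchIn i) ≈⟨ +-congˡ rest≈0 ⟩
    f i + 0#                  ≈⟨ +-identityʳ (f i) ⟩
    f i                       ∎
    where
    rest≈0 : sum (f ∘ punchIn i) ≈ 0#
    rest≈0 = trans (sum-cong-≋ (λ j → vanish (punchIn i j) (FinP.punchInᵢ≢i i j)))
                   (sum-replicate-zero k)

  diagonal⇒LinIndep : ∀ {n K} (φ : Fin K → EdgeFun ℝ n) (u w : Fin K → Fin n) →
    (∀ l → u l ≢ w l) → (∀ l → ¬ φ l (u l) (w l) ≈ 0#) →
    (∀ l l' → l' ≢ l → φ l' (u l) (w l) ≈ 0#) → LinIndep ℝ n K φ
  diagonal⇒LinIndep {K = K} φ u w u≢w diagonal offDiagonal a vanish l =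
    cancel-nonzeroʳ (diagonal l) (begin
      a l * φ l (u l) (w l)                       ≈⟨ sym (sum-single terms l others≈0) ⟩
      sumFin ℝ K terms                            ≈⟨ vanish (u l) (w l) (u≢w l) ⟩
      0#                                          ∎)
    where
    terms : Fin K → Carrier
    terms l' = a l' * φ l' (u l) (w l)
    others≈0 : ∀ l' → l' ≢ l → terms l' ≈ 0#
    others≈0 l' l'≢l = trans (*-congˡ (offDiagonal l l' l'≢l)) (zeroʳ (a l'))

  horner : ∀ {k} → Poly ℝ k → Carrier → Carrier
  horner {zero}  p x = 0#
  horner {suc k} p x = head p + x * horner (tail p) x

  eval-shift : ∀ {k} (q : Poly ℝ k) x →
    sumFin ℝ k (λ i → q i * pow ℝ x (toℕ (Fin.suc i))) ≈ x * eval ℝ q x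
  eval-shift {k} q x = begin
    sumFin ℝ k (λ i → q i * (x * xⁱ i))   ≡⟨ sumFin≡sum k _ ⟩
    sum (λ i → q i * (x * xⁱ i))          ≈⟨ sum-cong-≋ (λ i → x∙yz≈y∙xz (q i) x (xⁱ i)) ⟩
    sum (λ i → x * (q i * xⁱ i))          ≈⟨ sym (*-distribˡ-sum x (λ i → q i * xⁱ i)) ⟩
    x * sum (λ i → q i * xⁱ i)            ≡⟨ cong (x *_) (≡.sym (sumFin≡sum k _)) ⟩
    x * eval ℝ q x                        ∎
    where
    xⁱ : Fin k → Carrier
    xⁱ i = pow ℝ x (toℕ i)

  eval≈horner : ∀ {k} (p : Poly ℝ k) x → eval ℝ p x ≈ horner p x
  eval≈horner {zero}  p x = refl
  eval≈horner {suc k} p x =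
    +-cong (*-identityʳ (head p)) (trans (eval-shift (tail p) x) (*-congˡ (eval≈horner (tail p) x)))

  horner-cong : ∀ {k} (p : Poly ℝ k) {x x'} → x ≈ x' → horner p x ≈ horner p x'
  horner-cong {zero}  p x≈x' = refl
  horner-cong {suc k} p x≈x' = +-congˡ (*-cong x≈x' (horner-cong (tail p) x≈x'))

  eval-cong : ∀ {k} (p : Poly ℝ k) {x x'} → x ≈ x' → eval ℝ p x ≈ eval ℝ p x'
  eval-cong p {x} {x'} x≈x' =
    trans (eval≈horner p x) (trans (horner-cong p x≈x') (sym (eval≈horner p x')))

  addConst : ∀ {k} → Carrier → Poly ℝ (suc k) → Poly ℝ (suc k)
  addConst a q Fin.zero    = a + q Fin.zero
  addConst a q (Fin.suc i) = q (Fin.suc i)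

  horner-addConst : ∀ {k} a (q : Poly ℝ (suc k)) x → horner (addConst a q) x ≈ a + horner q x
  horner-addConst a q x = +-assoc a (head q) _

  -- Multiplication by the linear factor (x - ρ), based on
  -- (x - ρ)(p₀ + x p') = -ρ p₀ + x (p₀ + (x - ρ) p').
  mulLinear : ∀ {k} → Carrier → Poly ℝ k → Poly ℝ (suc k)
  mulLinear {zero}  ρ p i           = 0#
  mulLinear {suc k} ρ p Fin.zero    = - ρ * head p
  mulLinear {suc k} ρ p (Fin.suc i) = addConst (head p) (mulLinear ρ (tail p)) i

  horner-mulLinear : ∀ {k} ρ (p : Poly ℝ k) x → horner (mulLinear ρ p) x ≈ (x - ρ) * horner p x
  horner-mulLinear {zero}  ρ p x = trans (+-identityˡ (x * 0#)) (trans (zeroʳ x) (sym (zeroʳ (x - ρ))))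
  horner-mulLinear {suc k} ρ p x = begin
    - ρ * p₀ + x * horner (addConst p₀ (mulLinear ρ (tail p))) x
      ≈⟨ +-congˡ (*-congˡ (trans (horner-addConst p₀ (mulLinear ρ (tail p)) x) (+-congˡ (horner-mulLinear ρ (tail p) x)))) ⟩
    - ρ * p₀ + x * (p₀ + (x - ρ) * horner (tail p) x)
      ≈⟨ expand (- ρ) p₀ x (horner (tail p) x) ⟩
    (x - ρ) * (p₀ + x * horner (tail p) x) ∎
    where
    p₀ : Carrier
    p₀ = head p
    expand : ∀ ν a y h → ν * a + y * (a + (y + ν) * h) ≈ (y + ν) * (a + y * h)
    expand = solve 4 (λ ν a y h → ν :* a :+ y :* (a :+ (y :+ ν) :* h) := (y :+ ν) :* (a :+ y :* h)) refl

  rootProduct : ∀ {k} → (Fin k → Carrier) → Carrier → Carrier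
  rootProduct {zero}  ρ y = 1#
  rootProduct {suc k} ρ y = (y - head ρ) * rootProduct (tail ρ) y

  rootProduct-root : ∀ {k} (ρ : Fin k → Carrier) {y} t → ρ t ≈ y → rootProduct ρ y ≈ 0#
  rootProduct-root ρ {y} Fin.zero ρt≈y =
    trans (*-congʳ (trans (+-congˡ (-‿cong ρt≈y)) (-‿inverseʳ y))) (zeroˡ _)
  rootProduct-root ρ (Fin.suc t) ρt≈y = trans (*-congˡ (rootProduct-root (tail ρ) t ρt≈y)) (zeroʳ _)

  rootProduct-nonzero : ∀ {k} (ρ : Fin k → Carrier) {y} → (∀ t → ¬ ρ t ≈ y) → ¬ rootProduct ρ y ≈ 0#
  rootProduct-nonzero {zero}  ρ ρ≉y = 1≉0
  rootProduct-nonzero {suc k} ρ {y} ρ≉y = *-nonzero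
    (λ e → ρ≉y Fin.zero (sym (x∙y⁻¹≈ε⇒x≈y y (head ρ) e)))
    (rootProduct-nonzero (tail ρ) (ρ≉y ∘ Fin.suc))

  rootProduct-translate : ∀ {k} (ρ : Fin k → Carrier) a y →
    rootProduct (λ t → a + ρ t) (a + y) ≈ rootProduct ρ y
  rootProduct-translate {zero}  ρ a y = refl
  rootProduct-translate {suc k} ρ a y =
    *-cong difference (rootProduct-translate (tail ρ) a y)
    where
    regroup : ∀ a y ν μ → (a + y) + (ν + μ) ≈ (y + μ) + (a + ν)
    regroup = solve 4 (λ a y ν μ → (a :+ y) :+ (ν :+ μ) := (y :+ μ) :+ (a :+ ν)) refl
    difference : (a + y) - (a + head ρ) ≈ y - head ρ
    difference = begin
      (a + y) + - (a + head ρ)     ≈⟨ +-congˡ (sym (⁻¹-∙-comm a (head ρ))) ⟩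
      (a + y) + (- a + - head ρ)   ≈⟨ regroup a y (- a) (- head ρ) ⟩
      (y - head ρ) + (a + - a)     ≈⟨ +-congˡ (-‿inverseʳ a) ⟩
      (y - head ρ) + 0#            ≈⟨ +-identityʳ _ ⟩
      y - head ρ                   ∎

  scaledRootPoly : ∀ {k} → Carrier → (Fin k → Carrier) → Poly ℝ (suc k)
  scaledRootPoly {zero}  a ρ i = a
  scaledRootPoly {suc k} a ρ   = mulLinear (head ρ) (scaledRootPoly a (tail ρ))

  horner-scaledRootPoly : ∀ {k} a (ρ : Fin k → Carrier) x →
    horner (scaledRootPoly a ρ) x ≈ a * rootProduct ρ x
  horner-scaledRootPoly {zero}  a ρ x =
    trans (+-congˡ (zeroʳ x)) (trans (+-identityʳ a) (sym (*-identityʳ a)))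
  horner-scaledRootPoly {suc k} a ρ x = begin
    horner (mulLinear (head ρ) (scaledRootPoly a (tail ρ))) x
      ≈⟨ horner-mulLinear (head ρ) (scaledRootPoly a (tail ρ)) x ⟩
    (x - head ρ) * horner (scaledRootPoly a (tail ρ)) x
      ≈⟨ *-congˡ (horner-scaledRootPoly a (tail ρ) x) ⟩
    (x - head ρ) * (a * rootProduct (tail ρ) x)
      ≈⟨ x∙yz≈y∙xz (x - head ρ) a _ ⟩
    a * rootProduct ρ x ∎

  module SumColouring {n : ℕ} (s : Fin n → Carrier) where

    colour : EdgeFun ℝ n
    colour i j = s i + s j

    colour-proper : (∀ {i j} → s i ≈ s j → i ≡ j) → IsProperColoring ℝ n colour
    colour-proper s-injective =
      (λ i j _ → +-comm (s i) (s j)) ,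
      (λ i j k _ _ j≢k cᵢⱼ≈cᵢₖ → j≢k (s-injective (∙-cancelˡ (s i) (s j) (s k) cᵢⱼ≈cᵢₖ)))

    productForm : ∀ {k} → (Fin k → Carrier) → EdgeFun ℝ n
    productForm ρ i j = rootProduct ρ (s i) * rootProduct ρ (s j)

    productForm∈W : ∀ {k} (ρ : Fin k → Carrier) → InW ℝ n (suc k) colour (productForm ρ)
    productForm∈W {k} ρ = P , λ i j _ → P-at i j ,
      trans (eval-cong (P j) (+-comm (s i) (s j))) (trans (P-at j i) (*-comm _ _))
      where
      P : Fin n → Poly ℝ (suc k)
      P v = scaledRootPoly (rootProduct ρ (s v)) (λ t → s v + ρ t)
      P-at : ∀ v w → eval ℝ (P v) (s v + s w) ≈ productForm ρ v w
      P-at v w = begin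
        eval ℝ (P v) (s v + s w)
          ≈⟨ eval≈horner (P v) _ ⟩
        horner (P v) (s v + s w)
          ≈⟨ horner-scaledRootPoly _ (λ t → s v + ρ t) _ ⟩
        rootProduct ρ (s v) * rootProduct (λ t → s v + ρ t) (s v + s w)
          ≈⟨ *-congˡ (rootProduct-translate ρ (s v) (s w)) ⟩
        productForm ρ v w ∎

    module PairFamily (k : ℕ) (k+2≤n : suc (suc k) ℕ.≤ n)
                      (s-injective : ∀ {i j} → s i ≈ s j → i ≡ j) where

      open Pairs (suc (suc k))

      vertex : Fin (suc (suc k)) → Fin n
      vertex x = inject≤ x k+2≤n

      vertex-injective : ∀ {x y} → s (vertex x) ≈ s (vertex y) → x ≡ y
      vertex-injective e = FinP.inject≤-injective k+2≤n k+2≤n _ _ (s-injective e)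

      roots : Fin (pairCount (suc (suc k))) → Fin k → Carrier
      roots l t = s (vertex (others (lo≢hi l) t))

      φ : Fin (pairCount (suc (suc k))) → EdgeFun ℝ n
      φ l = productForm (roots l)

      V-vanishes : ∀ l x → ¬ x ∈ₚ l → rootProduct (roots l) (s (vertex x)) ≈ 0#
      V-vanishes l x x∉l with others-cover (lo≢hi l) (x∉l ∘ inj₁ ∘ ≡.sym) (x∉l ∘ inj₂ ∘ ≡.sym)
      ... | t , others≡x = rootProduct-root (roots l) t (reflexive (cong (s ∘ vertex) others≡x))

      V-nonzero : ∀ l x → x ∈ₚ l → ¬ rootProduct (roots l) (s (vertex x)) ≈ 0#
      V-nonzero l x (inj₁ x≡lo) = rootProduct-nonzero (roots l)
        (λ t e → others≢left (lo≢hi l) t (≡.trans (vertex-injective e) x≡lo))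
      V-nonzero l x (inj₂ x≡hi) = rootProduct-nonzero (roots l)
        (λ t e → others≢right (lo≢hi l) t (≡.trans (vertex-injective e) x≡hi))

      -- φ l is nonzero on the edge of l, and any other φ l' vanishes there.
      φ-independent : LinIndep ℝ n (pairCount (suc (suc k))) φ
      φ-independent = diagonal⇒LinIndep φ (vertex ∘ lo) (vertex ∘ hi)
        (λ l e → lo≢hi l (FinP.inject≤-injective k+2≤n k+2≤n _ _ e)) diagonal offDiagonal
        where
        diagonal : ∀ l → ¬ φ l (vertex (lo l)) (vertex (hi l)) ≈ 0#
        diagonal l = *-nonzero (V-nonzero l (lo l) (inj₁ ≡.refl)) (V-nonzero l (hi l) (inj₂ ≡.refl))
        offDiagonal : ∀ l l' → l' ≢ l → φ l' (vertex (lo l)) (vertex (hi l)) ≈ 0#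
        offDiagonal l l' l'≢l with pair-separated l'≢l
        ... | inj₁ lo∉ = trans (*-congʳ (V-vanishes l' (lo l) lo∉)) (zeroˡ _)
        ... | inj₂ hi∉ = trans (*-congˡ (V-vanishes l' (hi l) hi∉)) (zeroʳ _)

      dimW : DimW≥ ℝ n (suc k) colour (suc (suc k) C 2)
      dimW = subst (DimW≥ ℝ n (suc k) colour) (pairCount≡C2 (suc (suc k)))
        (φ , (λ l → productForm∈W (roots l)) , φ-independent)

  -- In an ordered field 1 > 0: otherwise 0 < -1, hence 0 < (-1)(-1) = 1 < 0.
  0<1 : 0# < 1#
  0<1 with compare 0# 1#
  ... | tri< 0<1 _ _ = 0<1
  ... | tri≈ _ 0≈1 _ = ⊥-elim (1≉0 (sym 0≈1))
  ... | tri> _ _ 1<0 = ⊥-elim (irrefl refl (<-trans 0<1′ 1<0))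
    where
    0<-1 : 0# < (- 1#)
    0<-1 = <-respˡ-≈ (trans (+-comm 1# (- 1#)) (-‿inverseˡ 1#))
                     (<-respʳ-≈ (+-identityˡ (- 1#)) (+-mono-< 1# 0# (- 1#) 1<0))
    0<1′ : 0# < 1#
    0<1′ = <-respʳ-≈ (trans (-1*x≈-x (- 1#)) (⁻¹-involutive 1#)) (*-pos _ _ 0<-1 0<-1)

  -- The canonical map ℕ → ℝ is strictly increasing, hence injective.
  natToℝ : ℕ → Carrier
  natToℝ zero    = 0#
  natToℝ (suc m) = 1# + natToℝ m

  x<1+x : ∀ x → x < (1# + x)
  x<1+x x = <-respˡ-≈ (+-identityˡ x) (+-mono-< 0# 1# x 0<1)

  natToℝ-mono : ∀ {m m'} → m ℕ.< m' → natToℝ m < natToℝ m'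
  natToℝ-mono {m} {suc m'} (ℕ.s≤s m≤m') with ℕP.m≤n⇒m<n∨m≡n m≤m'
  ... | inj₁ m<m' = <-trans (natToℝ-mono m<m') (x<1+x (natToℝ m'))
  ... | inj₂ ≡.refl = x<1+x (natToℝ m)

  natToℝ-injective : ∀ {m m'} → natToℝ m ≈ natToℝ m' → m ≡ m'
  natToℝ-injective {m} {m'} e with ℕP.<-cmp m m'
  ... | tri< m<m' _ _ = ⊥-elim (irrefl e (natToℝ-mono m<m'))
  ... | tri≈ _ m≡m' _ = m≡m'
  ... | tri> _ _ m>m' = ⊥-elim (irrefl (sym e) (natToℝ-mono m>m'))

-- ℕ addition is opened only here, as it would clash with the field's _+_ above.
open import Data.Nat using (_+_)

lemma3p3 : ∀ {c ℓ : Level} (ℝ : RealField c ℓ) (n r : ℕ) → NonZero n → NonZero r → n ≥ r + 1 →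
    ∃ λ (col : EdgeFun ℝ n) → IsProperColoring ℝ n col × DimW≥ ℝ n r col ((r + 1) C 2)
lemma3p3 ℝ n zero    _ r≢0 _ = ⊥-elim (NonZero.nonZero r≢0)
lemma3p3 ℝ n (suc k) _ _ n≥r+1 rewrite ℕP.+-comm k 1 =
  colour , colour-proper s-injective , dimW
  where
  s : Fin n → RealField.Carrier ℝ
  s = natToℝ ℝ ∘ toℕ
  s-injective : ∀ {i j} → RealField._≈_ ℝ (s i) (s j) → i ≡ j
  s-injective e = FinP.toℕ-injective (natToℝ-injective ℝ e)
  open SumColouring ℝ s
  open PairFamily k n≥r+1 s-injective
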